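{- $\mathbf{vD}$ is a Logic of Formal Inconsistency (LFI) with respect to $\neg$ and $\circ$; that is: (i) $\{\varphi,\neg\varphi\}\not\vdash_{\mathbf{vD}}\psi$ for some $\varphi,\psi\in\mathcal{L}$; (ii) there exist $\varphi,\psi\in\mathcal{L}$ such that $\{\circ\varphi,\varphi\}\not\vdash_{\mathbf{vD}}\psi$ and $\{\circ\varphi,\neg\varphi\}\not\vdash_{\mathbf{vD}}\psi$; (iii) $\{\circ\varphi,\varphi,\neg\varphi\}\vdash_{\mathbf{vD}}\psi$ for all $\varphi,\psi\in\mathcal{L}$.
   Context: Let $V$ be a denumerable set of propositional variables and $\mathcal{L}$ the set of formulas generated from $V$ by the binary connectives $\land,\lor,\longrightarrow$ and the unary connectives $\neg,\circ$. Fix a formula $\beta_0$ and set $\bot:=\beta_0\land(\neg\beta_0\land\circ\beta_0)$; for every formula $\alpha$ let $\sim\alpha$ abbreviate $\alpha\longrightarrow\bot$. The logic $\mathbf{vD}$ has axiom schemas (for all $\alpha,\beta,\gamma$, $\to$ denoting $\longrightarrow$): (1) $\alpha\to(\beta\to\alpha)$; (2) $(\alpha\to(\beta\to\gamma))\to((\alpha\to\beta)\to(\alpha\to\gamma))$; (3) $\alpha\to(\beta\to(\alpha\land\beta))$; (4) $(\alpha\land\beta)\to\alpha$; (5) $(\alpha\land\beta)\to\beta$; (6) $\alpha\to(\alpha\lor\beta)$; (7) $\beta\to(\alpha\lor\beta)$; (8) $(\alpha\to\beta)\lor\alpha$; (9) $\alpha\lor\neg\alpha$; (10) $(\alpha\to\gamma)\to((\neg\alpha\to\gamma)\to((\alpha\lor\neg\alpha)\to\gamma))$;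 (11) $((\alpha\to\beta)\to\gamma)\to((\alpha\to\gamma)\to(((\alpha\to\beta)\lor\alpha)\to\gamma))$; (12) $\circ\alpha\to(\alpha\to(\neg\alpha\to\beta))$; (13) $\circ\alpha\lor(\alpha\land\neg\alpha)$; (14) $(\circ\alpha\to\gamma)\to(((\alpha\land\neg\alpha)\to\gamma)\to((\circ\alpha\lor(\alpha\land\neg\alpha))\to\gamma))$; (15) $\sim\neg\alpha\to\sim\neg\sim\neg\alpha$; (16) $\sim\neg\sim\neg\alpha\to\sim\neg\alpha$; (17) $\sim\neg(\alpha\land\beta)\to(\sim\neg\alpha\land\sim\neg\beta)$; (18) $(\sim\neg\alpha\land\sim\neg\beta)\to\sim\neg(\alpha\land\beta)$; rules: (MP) from $\alpha$, $\alpha\longrightarrow\beta$ infer $\beta$; (N) from $\alpha$ infer $\neg\alpha\longrightarrow\sim\alpha$, applicable only when $\alpha$ is a theorem. A derivation of $\varphi$ from $\Gamma$ is a finite sequence ending in $\varphi$ each member of which is an axiom instance, a member of $\Gamma$, obtained by MP from earlier members, or obtained by (N) from an earlier member that is a theorem (derivable from $\emptyset$). $\Gamma\vdash_{\mathbf{vD}}\varphi$ iff such a derivation exists. -}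

module Defs where

open import Data.Nat using (ℕ)
open import Data.Sum using (_⊎_)
open import Data.Empty using (⊥)
open import Relation.Binary.PropositionalEquality using (_≡_)

infixr 5 _⇒_
infixl 7 _∧_
infixl 6 _∨_
data Formula : Set where
  var  : ℕ → Formula
  _∧_  : Formula → Formula → Formula
  _∨_  : Formula → Formula → Formula
  _⇒_  : Formula → Formula → Formula
  ¬'   : Formula → Formula
  ∘'   : Formula → Formula

Theory : Set₁
Theory = Formula → Set

∅ : Theory
∅ _ = ⊥

｛_,_｝ : Formula → Formula → Theory
｛ a , b ｝ x = (x ≡ a) ⊎ (x ≡ b)

｛_,_,_｝ : Formula → Formula → Formula → Theory
｛ a , b , c ｝ x = (x ≡ a) ⊎ ((x ≡ b) ⊎ (x ≡ c))

module vD (β₀ : Formula) where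

  ⊥f : Formula
  ⊥f = β₀ ∧ (¬' β₀ ∧ ∘' β₀)

  ∼ : Formula → Formula
  ∼ a = a ⇒ ⊥f

  data Axiom : Formula → Set where
    ax1  : ∀ a b → Axiom (a ⇒ (b ⇒ a))
    ax2  : ∀ a b c → Axiom ((a ⇒ (b ⇒ c)) ⇒ ((a ⇒ b) ⇒ (a ⇒ c)))
    ax3  : ∀ a b → Axiom (a ⇒ (b ⇒ (a ∧ b)))
    ax4  : ∀ a b → Axiom ((a ∧ b) ⇒ a)
    ax5  : ∀ a b → Axiom ((a ∧ b) ⇒ b)
    ax6  : ∀ a b → Axiom (a ⇒ (a ∨ b))
    ax7  : ∀ a b → Axiom (b ⇒ (a ∨ b))
    ax8  : ∀ a b → Axiom ((a ⇒ b) ∨ a)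
    ax9  : ∀ a → Axiom (a ∨ ¬' a)
    ax10 : ∀ a c → Axiom ((a ⇒ c) ⇒ ((¬' a ⇒ c) ⇒ ((a ∨ ¬' a) ⇒ c)))
    ax11 : ∀ a b c → Axiom (((a ⇒ b) ⇒ c) ⇒ ((a ⇒ c) ⇒ (((a ⇒ b) ∨ a) ⇒ c)))
    ax12 : ∀ a b → Axiom (∘' a ⇒ (a ⇒ (¬' a ⇒ b)))
    ax13 : ∀ a → Axiom (∘' a ∨ (a ∧ ¬' a))
    ax14 : ∀ a c → Axiom ((∘' a ⇒ c) ⇒ (((a ∧ ¬' a) ⇒ c) ⇒ ((∘' a ∨ (a ∧ ¬' a)) ⇒ c)))
    ax15 : ∀ a → Axiom (∼ (¬' a) ⇒ ∼ (¬' (∼ (¬' a))))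
    ax16 : ∀ a → Axiom (∼ (¬' (∼ (¬' a))) ⇒ ∼ (¬' a))
    ax17 : ∀ a b → Axiom (∼ (¬' (a ∧ b)) ⇒ (∼ (¬' a) ∧ ∼ (¬' b)))
    ax18 : ∀ a b → Axiom ((∼ (¬' a) ∧ ∼ (¬' b)) ⇒ ∼ (¬' (a ∧ b)))

  infix 3 _⊢_
  data _⊢_ (Γ : Theory) : Formula → Set where
    axiom : ∀ {φ} → Axiom φ → Γ ⊢ φ
    hyp   : ∀ {φ} → Γ φ → Γ ⊢ φ
    mp    : ∀ {φ ψ} → Γ ⊢ φ → Γ ⊢ (φ ⇒ ψ) → Γ ⊢ ψ
    nec   : ∀ {φ} → ∅ ⊢ φ → Γ ⊢ (¬' φ ⇒ ∼ φ)

-- vD is sound for a three-valued matrix with values 1, ½, 0, of which 1 and ½ are designated: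
-- ∧ is the minimum, ∨ and ⇒ are classical in designatedness, ¬ sends 1 to 0 and both ½ and 0
-- to 1, and ∘ is 0 exactly on ½. The only delicate point is rule (N): a theorem always takes the
-- value 1, because no variable is valid and every connective except ∧ is two-valued, so the
-- negation of a theorem is undesignated. Setting p to ½ refutes explosion for {p, ¬p}, and
-- setting p to 1 or 0 shows that ∘p alone does not explode; gentle explosion is axiom 12.
module Submission where

open import Defs
open import Data.Bool using (Bool; true; false; not; T) renaming (_∧_ to _&&_; _∨_ to _||_)
open import Data.Bool.Properties using (T-∧)
open import Data.Empty using (⊥-elim)
open import Data.Nat using (ℕ; zero; suc)
-- With _,_ in scope, ｛ a , b , c ｝ would parse ambiguously.
open import Data.Product using (Σ; _×_; proj₁; proj₂) renaming (_,_ to _,,_)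
open import Data.Sum using (inj₁; inj₂)
open import Data.Unit using (tt)
open import Function.Bundles using (Equivalence)
open import Relation.Binary.PropositionalEquality using (_≡_; refl; cong₂)
open import Relation.Nullary using (¬_)

data Val : Set where
  1ᵛ ½ᵛ 0ᵛ : Val

designated : Val → Bool
designated 0ᵛ = false
designated _  = true

Designated : Val → Set
Designated x = T (designated x)

boolean : Bool → Val
boolean true  = 1ᵛ
boolean false = 0ᵛ

infixl 7 _∧ᵛ_
infixl 6 _∨ᵛ_
infixr 5 _⇒ᵛ_

_∧ᵛ_ : Val → Val → Val
1ᵛ ∧ᵛ y  = y
½ᵛ ∧ᵛ 1ᵛ = ½ᵛ
½ᵛ ∧ᵛ y  = y
0ᵛ ∧ᵛ _  = 0ᵛ

_∨ᵛ_ : Val → Val → Val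
x ∨ᵛ y = boolean (designated x || designated y)

_⇒ᵛ_ : Val → Val → Val
x ⇒ᵛ y = boolean (not (designated x) || designated y)

¬ᵛ : Val → Val
¬ᵛ 1ᵛ = 0ᵛ
¬ᵛ ½ᵛ = 1ᵛ
¬ᵛ 0ᵛ = 1ᵛ

∘ᵛ : Val → Val
∘ᵛ ½ᵛ = 0ᵛ
∘ᵛ _  = 1ᵛ

Valuation : Set
Valuation = ℕ → Val

⟦_⟧ : Formula → Valuation → Val
⟦ var n ⟧  ρ = ρ n
⟦ a ∧ b ⟧  ρ = ⟦ a ⟧ ρ ∧ᵛ ⟦ b ⟧ ρ
⟦ a ∨ b ⟧  ρ = ⟦ a ⟧ ρ ∨ᵛ ⟦ b ⟧ ρ
⟦ a ⇒ b ⟧  ρ = ⟦ a ⟧ ρ ⇒ᵛ ⟦ b ⟧ ρ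
⟦ ¬' a ⟧   ρ = ¬ᵛ (⟦ a ⟧ ρ)
⟦ ∘' a ⟧   ρ = ∘ᵛ (⟦ a ⟧ ρ)

infix 4 _⊨_ _⊨*_

_⊨_ : Valuation → Formula → Set
ρ ⊨ φ = Designated (⟦ φ ⟧ ρ)

_⊨*_ : Valuation → Theory → Set
ρ ⊨* Γ = ∀ {ψ} → Γ ψ → ρ ⊨ ψ

⊨*-pair : ∀ {ρ a b} → ρ ⊨ a → ρ ⊨ b → ρ ⊨* ｛ a , b ｝
⊨*-pair ⊨a ⊨b (inj₁ refl) = ⊨a
⊨*-pair ⊨a ⊨b (inj₂ refl) = ⊨b

⇒ᵛ-elim : ∀ x y → Designated x → Designated (x ⇒ᵛ y) → Designated y
⇒ᵛ-elim 0ᵛ _  ()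
⇒ᵛ-elim 1ᵛ 0ᵛ _ ()
⇒ᵛ-elim ½ᵛ 0ᵛ _ ()
⇒ᵛ-elim _  1ᵛ _ _ = tt
⇒ᵛ-elim _  ½ᵛ _ _ = tt

∧ᵛ-designatedˡ : ∀ x y → Designated (x ∧ᵛ y) → Designated x
∧ᵛ-designatedˡ 1ᵛ _ _ = tt
∧ᵛ-designatedˡ ½ᵛ _ _ = tt

∧ᵛ-designatedʳ : ∀ x y → Designated (x ∧ᵛ y) → Designated y
∧ᵛ-designatedʳ 1ᵛ _  d = d
∧ᵛ-designatedʳ ½ᵛ 1ᵛ _ = tt
∧ᵛ-designatedʳ ½ᵛ ½ᵛ _ = tt

boolean-designated : ∀ b → Designated (boolean b) → boolean b ≡ 1ᵛ
boolean-designated true _ = refl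

¬ᵛ-designated : ∀ x → Designated (¬ᵛ x) → ¬ᵛ x ≡ 1ᵛ
¬ᵛ-designated ½ᵛ _ = refl
¬ᵛ-designated 0ᵛ _ = refl

∘ᵛ-designated : ∀ x → Designated (∘ᵛ x) → ∘ᵛ x ≡ 1ᵛ
∘ᵛ-designated 1ᵛ _ = refl
∘ᵛ-designated 0ᵛ _ = refl

valid⇒1ᵛ : ∀ φ → (∀ ρ → ρ ⊨ φ) → ∀ ρ → ⟦ φ ⟧ ρ ≡ 1ᵛ
valid⇒1ᵛ (var _) ⊨φ _ = ⊥-elim (⊨φ (λ _ → 0ᵛ))
valid⇒1ᵛ (a ∧ b) ⊨φ ρ = cong₂ _∧ᵛ_ (valid⇒1ᵛ a ⊨a ρ) (valid⇒1ᵛ b ⊨b ρ)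
  where
  ⊨a : ∀ ρ → ρ ⊨ a
  ⊨a ρ = ∧ᵛ-designatedˡ (⟦ a ⟧ ρ) (⟦ b ⟧ ρ) (⊨φ ρ)
  ⊨b : ∀ ρ → ρ ⊨ b
  ⊨b ρ = ∧ᵛ-designatedʳ (⟦ a ⟧ ρ) (⟦ b ⟧ ρ) (⊨φ ρ)
valid⇒1ᵛ (a ∨ b) ⊨φ ρ = boolean-designated _ (⊨φ ρ)
valid⇒1ᵛ (a ⇒ b) ⊨φ ρ = boolean-designated _ (⊨φ ρ)
valid⇒1ᵛ (¬' a)  ⊨φ ρ = ¬ᵛ-designated (⟦ a ⟧ ρ) (⊨φ ρ)
valid⇒1ᵛ (∘' a)  ⊨φ ρ = ∘ᵛ-designated (⟦ a ⟧ ρ) (⊨φ ρ)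

all-values : (Val → Bool) → Bool
all-values p = p 1ᵛ && (p ½ᵛ && p 0ᵛ)

all-values-sound : ∀ p → T (all-values p) → ∀ x → T (p x)
all-values-sound p h 1ᵛ = proj₁ (Equivalence.to (T-∧ {p 1ᵛ}) h)
all-values-sound p h ½ᵛ =
  proj₁ (Equivalence.to (T-∧ {p ½ᵛ}) (proj₂ (Equivalence.to (T-∧ {p 1ᵛ}) h)))
all-values-sound p h 0ᵛ =
  proj₂ (Equivalence.to (T-∧ {p ½ᵛ}) (proj₂ (Equivalence.to (T-∧ {p 1ᵛ}) h)))

Operation : ℕ → Set
Operation zero    = Val
Operation (suc n) = Val → Operation n

Tautology : ∀ n → Operation n → Set
Tautology zero    x = Designated x
Tautology (suc n) f = ∀ x → Tautology n (f x)

tautology? : ∀ n → Operation n → Bool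
tautology? zero    x = designated x
tautology? (suc n) f = all-values λ x → tautology? n (f x)

tautology : ∀ n (f : Operation n) → T (tautology? n f) → Tautology n f
tautology zero    x h   = h
tautology (suc n) f h x = tautology n (f x) (all-values-sound (λ x → tautology? n (f x)) h x)

module _ (β₀ : Formula) where
  open vD β₀

  -- Axioms 15–18 hold whatever value ⊥ takes, so ⊥ is checked as a free variable u.
  ⊨-axiom : ∀ {φ} → Axiom φ → ∀ ρ → ρ ⊨ φ
  ⊨-axiom (ax1 a b) ρ = tautology 2 (λ x y → x ⇒ᵛ y ⇒ᵛ x) _ (⟦ a ⟧ ρ) (⟦ b ⟧ ρ)
  ⊨-axiom (ax2 a b c) ρ =
    tautology 3 (λ x y z → (x ⇒ᵛ y ⇒ᵛ z) ⇒ᵛ (x ⇒ᵛ y) ⇒ᵛ x ⇒ᵛ z) _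
      (⟦ a ⟧ ρ) (⟦ b ⟧ ρ) (⟦ c ⟧ ρ)
  ⊨-axiom (ax3 a b) ρ = tautology 2 (λ x y → x ⇒ᵛ y ⇒ᵛ x ∧ᵛ y) _ (⟦ a ⟧ ρ) (⟦ b ⟧ ρ)
  ⊨-axiom (ax4 a b) ρ = tautology 2 (λ x y → x ∧ᵛ y ⇒ᵛ x) _ (⟦ a ⟧ ρ) (⟦ b ⟧ ρ)
  ⊨-axiom (ax5 a b) ρ = tautology 2 (λ x y → x ∧ᵛ y ⇒ᵛ y) _ (⟦ a ⟧ ρ) (⟦ b ⟧ ρ)
  ⊨-axiom (ax6 a b) ρ = tautology 2 (λ x y → x ⇒ᵛ x ∨ᵛ y) _ (⟦ a ⟧ ρ) (⟦ b ⟧ ρ)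
  ⊨-axiom (ax7 a b) ρ = tautology 2 (λ x y → y ⇒ᵛ x ∨ᵛ y) _ (⟦ a ⟧ ρ) (⟦ b ⟧ ρ)
  ⊨-axiom (ax8 a b) ρ = tautology 2 (λ x y → (x ⇒ᵛ y) ∨ᵛ x) _ (⟦ a ⟧ ρ) (⟦ b ⟧ ρ)
  ⊨-axiom (ax9 a) ρ = tautology 1 (λ x → x ∨ᵛ ¬ᵛ x) _ (⟦ a ⟧ ρ)
  ⊨-axiom (ax10 a c) ρ =
    tautology 2 (λ x z → (x ⇒ᵛ z) ⇒ᵛ (¬ᵛ x ⇒ᵛ z) ⇒ᵛ x ∨ᵛ ¬ᵛ x ⇒ᵛ z) _ (⟦ a ⟧ ρ) (⟦ c ⟧ ρ)
  ⊨-axiom (ax11 a b c) ρ =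
    tautology 3 (λ x y z → ((x ⇒ᵛ y) ⇒ᵛ z) ⇒ᵛ (x ⇒ᵛ z) ⇒ᵛ (x ⇒ᵛ y) ∨ᵛ x ⇒ᵛ z) _
      (⟦ a ⟧ ρ) (⟦ b ⟧ ρ) (⟦ c ⟧ ρ)
  ⊨-axiom (ax12 a b) ρ = tautology 2 (λ x y → ∘ᵛ x ⇒ᵛ x ⇒ᵛ ¬ᵛ x ⇒ᵛ y) _ (⟦ a ⟧ ρ) (⟦ b ⟧ ρ)
  ⊨-axiom (ax13 a) ρ = tautology 1 (λ x → ∘ᵛ x ∨ᵛ x ∧ᵛ ¬ᵛ x) _ (⟦ a ⟧ ρ)
  ⊨-axiom (ax14 a c) ρ =
    tautology 2 (λ x z → (∘ᵛ x ⇒ᵛ z) ⇒ᵛ (x ∧ᵛ ¬ᵛ x ⇒ᵛ z) ⇒ᵛ ∘ᵛ x ∨ᵛ x ∧ᵛ ¬ᵛ x ⇒ᵛ z) _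
      (⟦ a ⟧ ρ) (⟦ c ⟧ ρ)
  ⊨-axiom (ax15 a) ρ =
    tautology 2 (λ x u → (¬ᵛ x ⇒ᵛ u) ⇒ᵛ ¬ᵛ (¬ᵛ x ⇒ᵛ u) ⇒ᵛ u) _ (⟦ a ⟧ ρ) (⟦ ⊥f ⟧ ρ)
  ⊨-axiom (ax16 a) ρ =
    tautology 2 (λ x u → (¬ᵛ (¬ᵛ x ⇒ᵛ u) ⇒ᵛ u) ⇒ᵛ ¬ᵛ x ⇒ᵛ u) _ (⟦ a ⟧ ρ) (⟦ ⊥f ⟧ ρ)
  ⊨-axiom (ax17 a b) ρ =
    tautology 3 (λ x y u → (¬ᵛ (x ∧ᵛ y) ⇒ᵛ u) ⇒ᵛ (¬ᵛ x ⇒ᵛ u) ∧ᵛ (¬ᵛ y ⇒ᵛ u)) _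
      (⟦ a ⟧ ρ) (⟦ b ⟧ ρ) (⟦ ⊥f ⟧ ρ)
  ⊨-axiom (ax18 a b) ρ =
    tautology 3 (λ x y u → (¬ᵛ x ⇒ᵛ u) ∧ᵛ (¬ᵛ y ⇒ᵛ u) ⇒ᵛ ¬ᵛ (x ∧ᵛ y) ⇒ᵛ u) _
      (⟦ a ⟧ ρ) (⟦ b ⟧ ρ) (⟦ ⊥f ⟧ ρ)

  soundness : ∀ {Γ φ} → Γ ⊢ φ → ∀ {ρ} → ρ ⊨* Γ → ρ ⊨ φ
  soundness (axiom ax) {ρ} _ = ⊨-axiom ax ρ
  soundness (hyp φ∈Γ) ⊨Γ = ⊨Γ φ∈Γ
  soundness (mp {φ} {ψ} ⊢φ ⊢φ⇒ψ) {ρ} ⊨Γ =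
    ⇒ᵛ-elim (⟦ φ ⟧ ρ) (⟦ ψ ⟧ ρ) (soundness ⊢φ ⊨Γ) (soundness ⊢φ⇒ψ ⊨Γ)
  soundness (nec {φ} ⊢φ) {ρ} _ = ¬1ᵛ⇒ᵛ-designated (valid⇒1ᵛ φ (λ _ → soundness ⊢φ λ ()) ρ)
    where
    ¬1ᵛ⇒ᵛ-designated : ∀ {x y} → x ≡ 1ᵛ → Designated (¬ᵛ x ⇒ᵛ y)
    ¬1ᵛ⇒ᵛ-designated refl = tt

  countermodel⇒⊬ : ∀ {Γ ψ} ρ → ρ ⊨* Γ → ¬ ρ ⊨ ψ → ¬ (Γ ⊢ ψ)
  countermodel⇒⊬ ρ ⊨Γ ⊭ψ ⊢ψ = ⊭ψ (soundness ⊢ψ ⊨Γ)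

  gentle-explosion : ∀ φ ψ → ｛ ∘' φ , φ , ¬' φ ｝ ⊢ ψ
  gentle-explosion φ ψ =
    mp (hyp (inj₂ (inj₂ refl))) (mp (hyp (inj₂ (inj₁ refl))) (mp (hyp (inj₁ refl)) (axiom (ax12 φ ψ))))

p≔_ : Val → Valuation
(p≔ x) zero    = x
(p≔ x) (suc _) = 0ᵛ

corollary5p3 : (β₀ : Formula) → let open vD β₀ in
  (Σ Formula λ φ → Σ Formula λ ψ → ¬ (｛ φ , ¬' φ ｝ ⊢ ψ))
  × (Σ Formula λ φ → Σ Formula λ ψ →
       ¬ (｛ ∘' φ , φ ｝ ⊢ ψ) × ¬ (｛ ∘' φ , ¬' φ ｝ ⊢ ψ))
  × (∀ φ ψ → ｛ ∘' φ , φ , ¬' φ ｝ ⊢ ψ)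
corollary5p3 β₀ =
  (p ,, q ,, countermodel⇒⊬ β₀ (p≔ ½ᵛ) (⊨*-pair tt tt) λ ())
  ,, (p ,, q ,, countermodel⇒⊬ β₀ (p≔ 1ᵛ) (⊨*-pair tt tt) (λ ())
             ,, countermodel⇒⊬ β₀ (p≔ 0ᵛ) (⊨*-pair tt tt) (λ ()))
  ,, gentle-explosion β₀
  where
  p q : Formula
  p = var 0
  q = var 1
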